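{- Let $t<k-1$ be positive integers, let $2\le v_1\le v_2\le\cdots\le v_k$ be integers and $i\in\{1,\dots,k\}$. Then $$(\bar{1},t)\text{ -LAN}(k-1,(v_1,\dots,v_{i-1},v_{i+1},\dots,v_k))\le(\bar{1},t)\text{ -LAN}(k,(v_1,\dots,v_{i-1},v_i,v_{i+1},\dots,v_k)).$$
   Context: For positive integers $N,k,t$ and $v_1,\dots,v_k$, consider $N\times k$ arrays $A=(a_{rj})$ whose $j$-th column has entries from a set $V_j$ with $|V_j|=v_j$. A $t$-way interaction is $T=\{(j,\sigma_j):j\in I\}$ with $I\subseteq\{1,\dots,k\}$, $|I|=t$, $\sigma_j\in V_j$; $\rho(A,T)$ is the set of rows $r$ with $a_{rj}=\sigma_j$ for all $j\in I$, and $\rho(A,\mathcal T)=\bigcup_{T\in\mathcal T}\rho(A,T)$. $A$ is a $(\bar1,t)$-LA$(N;k,(v_1,\dots,v_k))$ if for all sets $\mathcal T_1,\mathcal T_2$ of $t$-way interactions with $|\mathcal T_1|,|\mathcal T_2|\le 1$: $\rho(A,\mathcal T_1)=\rho(A,\mathcal T_2)\iff\mathcal T_1=\mathcal T_2$. $(\bar1,t)$-LAN$(k,(v_1,\dots,v_k))$ is the minimum $N$ for which such an array exists. -}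

module Defs where

open import Data.Nat using (ℕ; _+_; _≤_)
open import Data.Fin using (Fin)
open import Data.Maybe using (Maybe; just; nothing; is-just)
open import Data.Bool using (if_then_else_)
open import Data.List using (map; allFin)
open import Data.Nat.ListAction using (sum)
open import Data.Product using (_×_; Σ)
open import Data.Unit using (⊤)
open import Data.Empty using (⊥)
open import Relation.Binary.PropositionalEquality using (_≡_)

Array : ℕ → (k : ℕ) → (Fin k → ℕ) → Set
Array N k v = Fin N → (j : Fin k) → Fin (v j)

-- An interaction {(j, σ_j) : j ∈ I} encoded as a partial assignment:
-- T j = just σ_j if j ∈ I, and nothing otherwise.
Interaction : (k : ℕ) → (Fin k → ℕ) → Set
Interaction k v = (j : Fin k) → Maybe (Fin (v j))

support : ∀ {k v} → Interaction k v → ℕ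
support {k} T = sum (map (λ j → if is-just (T j) then 1 else 0) (allFin k))

IsTWay : ∀ {k v} → ℕ → Interaction k v → Set
IsTWay t T = support T ≡ t

_≈I_ : ∀ {k v} → Interaction k v → Interaction k v → Set
T₁ ≈I T₂ = ∀ j → T₁ j ≡ T₂ j

Covers : ∀ {N k v} → Array N k v → Interaction k v → Fin N → Set
Covers A T r = ∀ j x → T j ≡ just x → A r j ≡ x

-- A set 𝒯 of t-way interactions with |𝒯| ≤ 1 is encoded as Maybe Interaction
-- (nothing = ∅, just T = {T}).
Adm : ∀ {k v} → ℕ → Maybe (Interaction k v) → Set
Adm t nothing = ⊤
Adm t (just T) = IsTWay t T

InRho : ∀ {N k v} → Array N k v → Maybe (Interaction k v) → Fin N → Set
InRho A nothing r = ⊥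
InRho A (just T) r = Covers A T r

SameRows : ∀ {N k v} → Array N k v → Maybe (Interaction k v) → Maybe (Interaction k v) → Set
SameRows {N} A 𝒯₁ 𝒯₂ = ∀ (r : Fin N) → (InRho A 𝒯₁ r → InRho A 𝒯₂ r) × (InRho A 𝒯₂ r → InRho A 𝒯₁ r)

EqSet : ∀ {k v} → Maybe (Interaction k v) → Maybe (Interaction k v) → Set
EqSet nothing nothing = ⊤
EqSet nothing (just _) = ⊥
EqSet (just _) nothing = ⊥
EqSet (just T₁) (just T₂) = T₁ ≈I T₂

IsLA : (t N k : ℕ) (v : Fin k → ℕ) → Array N k v → Set
IsLA t N k v A = ∀ (𝒯₁ 𝒯₂ : Maybe (Interaction k v)) → Adm t 𝒯₁ → Adm t 𝒯₂ →
  (SameRows A 𝒯₁ 𝒯₂ → EqSet 𝒯₁ 𝒯₂) × (EqSet 𝒯₁ 𝒯₂ → SameRows A 𝒯₁ 𝒯₂)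

HasLA : (t N k : ℕ) → (Fin k → ℕ) → Set
HasLA t N k v = Σ (Array N k v) (IsLA t N k v)

IsLAN : (t k : ℕ) → (Fin k → ℕ) → ℕ → Set
IsLAN t k v n = HasLA t n k v × (∀ m → HasLA t m k v → n ≤ m)

-- Deleting a column i from a (1̄,t)-locating array leaves a (1̄,t)-locating array:
-- t-way interactions of the smaller array are exactly the t-way interactions of
-- the larger one avoiding column i, with the same row sets, so distinct ones
-- still have distinct row sets. Hence any LA on k+1 columns yields one with as
-- many rows on the remaining k columns.
module Submission where

open import Level using (Level)
open import Data.Nat using (ℕ; zero; suc; _+_; _≤_; _<_)
open import Data.Nat.Properties using (+-0-commutativeMonoid)
open import Data.Nat.ListAction using (sum)
open import Data.Fin using (Fin; zero; suc; punchIn)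
import Data.Fin
open import Data.Bool using (if_then_else_)
open import Data.List using (map; allFin; tabulate)
open import Data.List.Properties using (map-tabulate)
open import Data.Maybe using (Maybe; just; nothing; is-just)
import Data.Maybe as Maybe
open import Data.Product using (_,_; proj₁; proj₂)
open import Data.Unit using (tt)
open import Function using (_∘_; id)
open import Relation.Binary.PropositionalEquality
open import Algebra.Properties.CommutativeMonoid.Sum +-0-commutativeMonoid
  using (sum-remove; sum-cong-≗) renaming (sum to ∑)

open import Defs

private
  variable
    a ℓ : Level
    n k t N : ℕ

insertAtᵈ : {P : Fin (suc n) → Set a} (i : Fin (suc n)) →
            ((j : Fin n) → P (punchIn i j)) → P i → (j : Fin (suc n)) → P j
insertAtᵈ                     zero    xs x zero    = x
insertAtᵈ                     zero    xs x (suc j) = xs j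
insertAtᵈ {n = suc n}         (suc i) xs x zero    = xs zero
insertAtᵈ {n = suc n} {P = P} (suc i) xs x (suc j) = insertAtᵈ {P = P ∘ suc} i (xs ∘ suc) x j

insertAtᵈ-lookup : {P : Fin (suc n) → Set a} (i : Fin (suc n))
                   (xs : (j : Fin n) → P (punchIn i j)) (x : P i) →
                   insertAtᵈ {P = P} i xs x i ≡ x
insertAtᵈ-lookup                     zero    xs x = refl
insertAtᵈ-lookup {n = suc n} {P = P} (suc i) xs x = insertAtᵈ-lookup {P = P ∘ suc} i (xs ∘ suc) x

insertAtᵈ-punchIn : {P : Fin (suc n) → Set a} (i : Fin (suc n))
                    (xs : (j : Fin n) → P (punchIn i j)) (x : P i) (j : Fin n) →
                    insertAtᵈ {P = P} i xs x (punchIn i j) ≡ xs j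
insertAtᵈ-punchIn                     zero    xs x j       = refl
insertAtᵈ-punchIn {n = suc n}         (suc i) xs x zero    = refl
insertAtᵈ-punchIn {n = suc n} {P = P} (suc i) xs x (suc j) =
  insertAtᵈ-punchIn {P = P ∘ suc} i (xs ∘ suc) x j

insertAtᵈ-elim : {P : Fin (suc n) → Set a} (Q : (j : Fin (suc n)) → P j → Set ℓ)
                 (i : Fin (suc n)) (xs : (j : Fin n) → P (punchIn i j)) (x : P i) →
                 Q i x → (∀ j → Q (punchIn i j) (xs j)) →
                 ∀ j → Q j (insertAtᵈ {P = P} i xs x j)
insertAtᵈ-elim                     Q zero    xs x qx qxs zero    = qx
insertAtᵈ-elim                     Q zero    xs x qx qxs (suc j) = qxs j
insertAtᵈ-elim {n = suc n}         Q (suc i) xs x qx qxs zero    = qxs zero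
insertAtᵈ-elim {n = suc n} {P = P} Q (suc i) xs x qx qxs (suc j) =
  insertAtᵈ-elim {P = P ∘ suc} (Q ∘ suc) i (xs ∘ suc) x qx (qxs ∘ suc) j

sum-map-allFin : (f : Fin n → ℕ) → sum (map f (allFin n)) ≡ ∑ f
sum-map-allFin f = trans (cong sum (map-tabulate id f)) (sum-tabulate f)
  where
  sum-tabulate : (g : Fin n → ℕ) → sum (tabulate g) ≡ ∑ g
  sum-tabulate {zero}  g = refl
  sum-tabulate {suc n} g = cong (g zero +_) (sum-tabulate (g ∘ suc))

module _ {v : Fin (suc k) → ℕ} (i : Fin (suc k)) where

  deleteColumn : Array N (suc k) v → Array N k (v ∘ punchIn i)
  deleteColumn A r = A r ∘ punchIn i

  padAt : Interaction k (v ∘ punchIn i) → Interaction (suc k) v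
  padAt T = insertAtᵈ i T nothing

  padAt-punchIn : ∀ T j → padAt T (punchIn i j) ≡ T j
  padAt-punchIn T = insertAtᵈ-punchIn i T nothing

  support-padAt : ∀ T → support (padAt T) ≡ support T
  support-padAt T = begin
    support (padAt T)                                           ≡⟨ sum-map-allFin (indicator (padAt T)) ⟩
    ∑ (indicator (padAt T))                                     ≡⟨ sum-remove (indicator (padAt T)) ⟩
    indicator (padAt T) i + ∑ (indicator (padAt T) ∘ punchIn i) ≡⟨ cong₂ _+_ padAt-unused (sum-cong-≗ padAt-rest) ⟩
    ∑ (indicator T)                                             ≡⟨ sum-map-allFin (indicator T) ⟨
    support T                                                   ∎
    where
    open ≡-Reasoning
    count : ∀ {V : Set} → Maybe V → ℕ
    count z = if is-just z then 1 else 0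
    indicator : ∀ {m} {w : Fin m → ℕ} → Interaction m w → Fin m → ℕ
    indicator U = count ∘ U
    padAt-unused : indicator (padAt T) i ≡ 0
    padAt-unused = cong count (insertAtᵈ-lookup i T nothing)
    padAt-rest : ∀ j → indicator (padAt T) (punchIn i j) ≡ indicator T j
    padAt-rest j = cong count (padAt-punchIn T j)

  module _ (A : Array N (suc k) v) where

    covers-padAt⁺ : ∀ T r → Covers (deleteColumn A) T r → Covers A (padAt T) r
    covers-padAt⁺ T r c = insertAtᵈ-elim (λ j y → ∀ x → y ≡ just x → A r j ≡ x)
      i T nothing (λ _ ()) c

    covers-padAt⁻ : ∀ T r → Covers A (padAt T) r → Covers (deleteColumn A) T r
    covers-padAt⁻ T r c j x eq = c (punchIn i j) x (trans (padAt-punchIn T j) eq)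

    inRho-padAt⁺ : ∀ 𝒯 r → InRho (deleteColumn A) 𝒯 r → InRho A (Maybe.map padAt 𝒯) r
    inRho-padAt⁺ nothing  r ()
    inRho-padAt⁺ (just T) = covers-padAt⁺ T

    inRho-padAt⁻ : ∀ 𝒯 r → InRho A (Maybe.map padAt 𝒯) r → InRho (deleteColumn A) 𝒯 r
    inRho-padAt⁻ nothing  r ()
    inRho-padAt⁻ (just T) = covers-padAt⁻ T

  adm-padAt : ∀ 𝒯 → Adm t 𝒯 → Adm t (Maybe.map padAt 𝒯)
  adm-padAt nothing  _ = tt
  adm-padAt (just T) a = trans (support-padAt T) a

  eqSet-padAt⁻ : ∀ 𝒯₁ 𝒯₂ → EqSet (Maybe.map padAt 𝒯₁) (Maybe.map padAt 𝒯₂) → EqSet 𝒯₁ 𝒯₂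
  eqSet-padAt⁻ nothing   nothing   _ = tt
  eqSet-padAt⁻ (just T₁) (just T₂) e j = begin
    T₁ j                   ≡⟨ padAt-punchIn T₁ j ⟨
    padAt T₁ (punchIn i j) ≡⟨ e (punchIn i j) ⟩
    padAt T₂ (punchIn i j) ≡⟨ padAt-punchIn T₂ j ⟩
    T₂ j                   ∎
    where open ≡-Reasoning

sameRows-of-eqSet : ∀ {v : Fin k → ℕ} (A : Array N k v) 𝒯₁ 𝒯₂ → EqSet 𝒯₁ 𝒯₂ → SameRows A 𝒯₁ 𝒯₂
sameRows-of-eqSet A nothing   nothing   _ r = id , id
sameRows-of-eqSet A (just T₁) (just T₂) e r =
  (λ c j x eq → c j x (trans (e j) eq)) , (λ c j x eq → c j x (trans (sym (e j)) eq))

isLA-deleteColumn : ∀ {v : Fin (suc k) → ℕ} (i : Fin (suc k)) (A : Array N (suc k) v) →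
                    IsLA t N (suc k) v A → IsLA t N k (v ∘ punchIn i) (deleteColumn i A)
isLA-deleteColumn i A la 𝒯₁ 𝒯₂ a₁ a₂ = locates , sameRows-of-eqSet (deleteColumn i A) 𝒯₁ 𝒯₂
  where
  locates : SameRows (deleteColumn i A) 𝒯₁ 𝒯₂ → EqSet 𝒯₁ 𝒯₂
  locates same = eqSet-padAt⁻ i 𝒯₁ 𝒯₂
    (proj₁ (la _ _ (adm-padAt i 𝒯₁ a₁) (adm-padAt i 𝒯₂ a₂)) λ r →
        (inRho-padAt⁺ i A 𝒯₂ r ∘ proj₁ (same r) ∘ inRho-padAt⁻ i A 𝒯₁ r)
      , (inRho-padAt⁺ i A 𝒯₁ r ∘ proj₂ (same r) ∘ inRho-padAt⁻ i A 𝒯₂ r))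

hasLA-deleteColumn : ∀ {v : Fin (suc k) → ℕ} (i : Fin (suc k)) →
                     HasLA t N (suc k) v → HasLA t N k (v ∘ punchIn i)
hasLA-deleteColumn i (A , la) = deleteColumn i A , isLA-deleteColumn i A la

lemma4p7 : (k t : ℕ) (v : Fin (Data.Nat.suc k) → ℕ) (i : Fin (Data.Nat.suc k)) →
    1 ≤ t → t < k →
    (∀ j → 2 ≤ v j) → (∀ j j′ → j Data.Fin.≤ j′ → v j ≤ v j′) →
    ∀ n m → IsLAN t k (v ∘ punchIn i) n → IsLAN t (Data.Nat.suc k) v m → n ≤ m
lemma4p7 k t v i _ _ _ _ n m (_ , n-minimal) (LA-m , _) = n-minimal m (hasLA-deleteColumn i LA-m)
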